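{- Let $C : \mathsf{Form} \to \mathsf{Prop}$ be any predicate, $\mathsf{Code}$ any type and $\mathsf{eval} : \mathsf{Code} \to \mathsf{Code} \to \mathsf{Form}$ any function, and assume that for every function $f : \mathsf{Code} \to \mathsf{Form}$ there exists $c \in \mathsf{Code}$ such that for all $x \in \mathsf{Code}$, $\mathsf{eval}(c,x) \simeq_C f(x)$. Then for every function $g : \mathsf{Form} \to \mathsf{Form}$ there exists a formula $B$ with $B \simeq_C g(B)$.
   Context: $\mathsf{Form}$ is the type of closed formulas generated by $A,B ::= \bot \mid A \to B$. For a predicate $C$ on $\mathsf{Form}$, $A \simeq_C B$ means $C(A \to B) \land C(B \to A)$. -}

module Defs where

open import Data.Product using (_×_)

data Form : Set where
  bot : Form
  _⇒_ : Form → Form → Form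

infixr 6 _⇒_

_≃[_]_ : Form → (Form → Set) → Form → Set
A ≃[ C ] B = C (A ⇒ B) × C (B ⇒ A)

{-# OPTIONS --safe #-}
module Submission where

open import Data.Product using (Σ; _,_)

open import Defs

diagonal-fixed-point : ∀ {a c ℓ} {A : Set a} {Code : Set c}
  (_≈_ : A → A → Set ℓ) (eval : Code → Code → A)
  → ((f : Code → A) → Σ Code (λ e → (x : Code) → eval e x ≈ f x))
  → (g : A → A) → Σ A (λ B → B ≈ g B)
diagonal-fixed-point _≈_ eval represent g with represent (λ x → g (eval x x))
... | d , d-represents-diagonal = eval d d , d-represents-diagonal d

lemma3p1 : (C : Form → Set) (Code : Set) (eval : Code → Code → Form)
    → ((f : Code → Form) → Σ Code (λ c → (x : Code) → eval c x ≃[ C ] f x))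
    → (g : Form → Form) → Σ Form (λ B → B ≃[ C ] g B)
lemma3p1 C Code eval = diagonal-fixed-point _≃[ C ]_ eval
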